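{- For every closed System T term $t$ of type $(\iota\Rightarrow\iota)\Rightarrow\iota$, we have $[\![\mathsf{maxBQ}^T\,(\mathsf{dialogueTree}_\iota(t))]\!]=\mathsf{maxBQ}(\mathsf{prune}(\mathsf{dialogueTree}(t)))$.
   Context: Metatheory: constructive Martin-Löf type theory without function extensionality; $\mathsf{Natrec}\,f\,x\,0=x$, $\mathsf{Natrec}\,f\,x\,(n+1)=f\,n\,(\mathsf{Natrec}\,f\,x\,n)$; $\mathbb{B}$ the booleans, $\mathsf{emb}(\mathsf{false})=0$, $\mathsf{emb}(\mathsf{true})=1$. System T: types from base $\iota$ and $\sigma\Rightarrow\tau$; terms: variables, $\mathsf{zero}$, $\mathsf{succ}\,t$, $\mathsf{rec}_\sigma\,t\,p\,q:\sigma$ ($t:\iota\Rightarrow\sigma\Rightarrow\sigma$, $p:\sigma$, $q:\iota$), $\lambda$, application; numerals $\underline0=\mathsf{zero}$, $\underline{n+1}=\mathsf{succ}\,\underline n$. Set interpretation $[\![\iota]\!]=\mathbb{N}$, $[\![\sigma\Rightarrow\tau]\!]=[\![\sigma]\!]\to[\![\tau]\!]$, standard on terms. Dialogue trees $\mathcal{D}(I,O,X)$: constructors $\eta\,x$, $\beta\,\varphi\,i$ ($\varphi:O\to\mathcal{D}(I,O,X)$, $i:I$); $\mathcal{D}_{\mathbb N}\mathbb{N}:=\mathcal{D}(\mathbb{N},\mathbb{N},\mathbb{N})$. Kleisli $f^\sharp(\eta\,x)=f\,x$, $f^\sharp(\beta\,\varphi\,i)=\beta(\lambda o.f^\sharp(\varphi\,o))\,i$;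 $\mathsf{map}\,f=(\eta\circ f)^\sharp$. $\mathcal{B}[\![\iota]\!]=\mathcal{D}_{\mathbb N}\mathbb{N}$, arrows to function types; $\mathsf{ext}_\iota f\,d=f^\sharp d$, $\mathsf{ext}_{\sigma_1\Rightarrow\sigma_2}f\,d\,s=\mathsf{ext}_{\sigma_2}(\lambda x.f\,x\,s)\,d$; $\mathcal{B}[\![\mathsf{zero}]\!]\gamma=\eta\,0$, $\mathcal{B}[\![\mathsf{succ}\,t]\!]\gamma=\mathsf{map}(\lambda n.n+1)(\mathcal{B}[\![t]\!]\gamma)$, $\mathcal{B}[\![\mathsf{rec}_\sigma t_1t_2t_3]\!]\gamma=\mathsf{ext}_\sigma(\mathsf{Natrec}(\mathcal{B}[\![t_1]\!]\gamma\circ\eta)(\mathcal{B}[\![t_2]\!]\gamma))(\mathcal{B}[\![t_3]\!]\gamma)$, variables/$\lambda$/application standard. $\mathsf{generic}:=(\lambda i.\beta\,\eta\,i)^\sharp$; $\mathsf{dialogueTree}(t):=\mathcal{B}[\![t]\!]\,\mathsf{generic}$. $\mathsf{prune}(\eta\,n)=\eta\,n$, $\mathsf{prune}(\beta\,\varphi\,n)=\beta(\mathsf{prune}\circ\varphi\circ\mathsf{emb})\,n$. $\mathsf{maxBQ}(\eta\,n)=0$, $\mathsf{maxBQ}(\beta\,\varphi\,n)=\max(n,\max(\mathsf{maxBQ}(\varphi\,\mathsf{false}),\mathsf{maxBQ}(\varphi\,\mathsf{true})))$. Internal: $\mathsf{ChD}_A(\sigma):=(\sigma\Rightarrow A)\Rightarrow((\iota\Rightarrow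 A)\Rightarrow\iota\Rightarrow A)\Rightarrow A$; $\eta_A:=\lambda z\,e\,b.\,e\,z$; $\beta_A:=\lambda\varphi\,x\,e\,b.\,b(\lambda y.\varphi\,y\,e\,b)\,x$; $K_A:=\lambda f\,d\,e'\,b'.\,d(\lambda x.f\,x\,e'\,b')\,b'$; $\mathsf{map}_A:=\lambda f.K_A(\lambda x.\eta_A(f\,x))$. $\lceil\iota\rceil_A=\mathsf{ChD}_A(\iota)$, arrows homomorphically. $\mathsf{ext}^T_{\iota,A}:=K_A$, $\mathsf{ext}^T_{\sigma_1\Rightarrow\sigma_2,A}:=\lambda f\,d\,s.\mathsf{ext}^T_{\sigma_2,A}(\lambda x.f\,x\,s)\,d$. $\lceil x\rceil_A=x$, $\lceil\mathsf{zero}\rceil_A=\eta_A\,\mathsf{zero}$, $\lceil\mathsf{succ}\,t\rceil_A=\mathsf{map}_A(\lambda n.\mathsf{succ}\,n)\lceil t\rceil_A$, $\lceil\mathsf{rec}_\sigma t_1t_2t_3\rceil_A=\mathsf{ext}^T_{\sigma,A}(\lambda n.\mathsf{rec}_{\lceil\sigma\rceil_A}(\lambda x.\lceil t_1\rceil_A(\eta_A x))\lceil t_2\rceil_A\,n)\lceil t_3\rceil_A$, $\lambda$/application homomorphically. $\mathsf{generic}_A:=K_A(\lambda i.\beta_A\,\eta_A\,i)$; $\mathsf{dialogueTree}_A(t):=\lceil t\rceil_A\,\mathsf{generic}_A$. Fix closed $\mathsf{max}^T$ with $[\![\mathsf{max}^T]\!]\,a\,b=\max(a,b)$; $\mathsf{maxBQ}^T:=\lambda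 d.\,d\,(\lambda w.\mathsf{zero})\,(\lambda g\,x.\,\mathsf{max}^T\,x\,(\mathsf{max}^T\,(g\,\underline0)\,(g\,\underline1)))$. -}

module Defs where

open import Data.Nat using (ℕ; zero; suc; _⊔_)
open import Data.Bool using (Bool; true; false)

infixr 5 _⇒_
data Ty : Set where
  ι   : Ty
  _⇒_ : Ty → Ty → Ty

infixl 4 _,_
data Ctx : Set where
  ∅   : Ctx
  _,_ : Ctx → Ty → Ctx

infix 3 _∋_
data _∋_ : Ctx → Ty → Set where
  vz : ∀ {Γ σ} → Γ , σ ∋ σ
  vs : ∀ {Γ σ τ} → Γ ∋ σ → Γ , τ ∋ σ

data Tm (Γ : Ctx) : Ty → Set where
  var  : ∀ {σ} → Γ ∋ σ → Tm Γ σ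
  Zero : Tm Γ ι
  Succ : Tm Γ ι → Tm Γ ι
  Rec  : ∀ {σ} → Tm Γ (ι ⇒ σ ⇒ σ) → Tm Γ σ → Tm Γ ι → Tm Γ σ
  lam  : ∀ {σ τ} → Tm (Γ , σ) τ → Tm Γ (σ ⇒ τ)
  app  : ∀ {σ τ} → Tm Γ (σ ⇒ τ) → Tm Γ σ → Tm Γ τ

numeral : ∀ {Γ} → ℕ → Tm Γ ι
numeral zero    = Zero
numeral (suc n) = Succ (numeral n)

Ren : Ctx → Ctx → Set
Ren Γ Δ = ∀ {σ} → Γ ∋ σ → Δ ∋ σ

liftRen : ∀ {Γ Δ τ} → Ren Γ Δ → Ren (Γ , τ) (Δ , τ)
liftRen ρ vz     = vz
liftRen ρ (vs x) = vs (ρ x)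

ren : ∀ {Γ Δ σ} → Ren Γ Δ → Tm Γ σ → Tm Δ σ
ren ρ (var x)     = var (ρ x)
ren ρ Zero        = Zero
ren ρ (Succ t)    = Succ (ren ρ t)
ren ρ (Rec t p q) = Rec (ren ρ t) (ren ρ p) (ren ρ q)
ren ρ (lam t)     = lam (ren (liftRen ρ) t)
ren ρ (app t u)   = app (ren ρ t) (ren ρ u)

wk : ∀ {Γ σ τ} → Tm Γ σ → Tm (Γ , τ) σ
wk = ren vs

emptyRen : ∀ {Γ} → Ren ∅ Γ
emptyRen ()

closed : ∀ {Γ σ} → Tm ∅ σ → Tm Γ σ
closed = ren emptyRen

Natrec : {X : Set} → (ℕ → X → X) → X → ℕ → X
Natrec f x zero    = x
Natrec f x (suc n) = f n (Natrec f x n)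

⟦_⟧ty : Ty → Set
⟦ ι ⟧ty     = ℕ
⟦ σ ⇒ τ ⟧ty = ⟦ σ ⟧ty → ⟦ τ ⟧ty

Env : Ctx → Set
Env Γ = ∀ {σ} → Γ ∋ σ → ⟦ σ ⟧ty

extEnv : ∀ {Γ σ} → Env Γ → ⟦ σ ⟧ty → Env (Γ , σ)
extEnv γ a vz     = a
extEnv γ a (vs x) = γ x

emptyEnv : Env ∅
emptyEnv ()

⟦_⟧ : ∀ {Γ σ} → Tm Γ σ → Env Γ → ⟦ σ ⟧ty
⟦ var x ⟧ γ     = γ x
⟦ Zero ⟧ γ      = 0
⟦ Succ t ⟧ γ    = suc (⟦ t ⟧ γ)
⟦ Rec t p q ⟧ γ = Natrec (⟦ t ⟧ γ) (⟦ p ⟧ γ) (⟦ q ⟧ γ)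
⟦ lam t ⟧ γ     = λ a → ⟦ t ⟧ (extEnv γ a)
⟦ app t u ⟧ γ   = ⟦ t ⟧ γ (⟦ u ⟧ γ)

⟦_⟧₀ : ∀ {σ} → Tm ∅ σ → ⟦ σ ⟧ty
⟦ t ⟧₀ = ⟦ t ⟧ emptyEnv

data D (I O X : Set) : Set where
  η : X → D I O X
  β : (O → D I O X) → I → D I O X

kleisli : ∀ {I O X Y : Set} → (X → D I O Y) → D I O X → D I O Y
kleisli f (η x)   = f x
kleisli f (β φ i) = β (λ o → kleisli f (φ o)) i

mapD : ∀ {I O X Y : Set} → (X → Y) → D I O X → D I O Y
mapD f = kleisli (λ x → η (f x))

Dℕ : Set
Dℕ = D ℕ ℕ ℕ

B⟦_⟧ty : Ty → Set
B⟦ ι ⟧ty     = Dℕ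
B⟦ σ ⇒ τ ⟧ty = B⟦ σ ⟧ty → B⟦ τ ⟧ty

ext : ∀ σ → (ℕ → B⟦ σ ⟧ty) → Dℕ → B⟦ σ ⟧ty
ext ι           f d   = kleisli f d
ext (σ₁ ⇒ σ₂)   f d s = ext σ₂ (λ x → f x s) d

BEnv : Ctx → Set
BEnv Γ = ∀ {σ} → Γ ∋ σ → B⟦ σ ⟧ty

extBEnv : ∀ {Γ σ} → BEnv Γ → B⟦ σ ⟧ty → BEnv (Γ , σ)
extBEnv γ a vz     = a
extBEnv γ a (vs x) = γ x

emptyBEnv : BEnv ∅
emptyBEnv ()

B⟦_⟧ : ∀ {Γ σ} → Tm Γ σ → BEnv Γ → B⟦ σ ⟧ty
B⟦ var x ⟧ γ             = γ x
B⟦ Zero ⟧ γ              = η 0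
B⟦ Succ t ⟧ γ            = mapD suc (B⟦ t ⟧ γ)
B⟦ Rec {σ} t₁ t₂ t₃ ⟧ γ  = ext σ (Natrec (λ n → B⟦ t₁ ⟧ γ (η n)) (B⟦ t₂ ⟧ γ)) (B⟦ t₃ ⟧ γ)
B⟦ lam t ⟧ γ             = λ a → B⟦ t ⟧ (extBEnv γ a)
B⟦ app t u ⟧ γ           = B⟦ t ⟧ γ (B⟦ u ⟧ γ)

generic : Dℕ → Dℕ
generic = kleisli (λ i → β η i)

dialogueTree : Tm ∅ ((ι ⇒ ι) ⇒ ι) → Dℕ
dialogueTree t = B⟦ t ⟧ emptyBEnv generic

emb : Bool → ℕ
emb false = 0
emb true  = 1

prune : Dℕ → D ℕ Bool ℕ
prune (η n)   = η n
prune (β φ n) = β (λ b → prune (φ (emb b))) n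

maxBQ : D ℕ Bool ℕ → ℕ
maxBQ (η n)   = 0
maxBQ (β φ n) = n ⊔ (maxBQ (φ false) ⊔ maxBQ (φ true))

-- Internal (Church-encoded) dialogue translation, parameterised by A

ChD : Ty → Ty → Ty
ChD A σ = (σ ⇒ A) ⇒ ((ι ⇒ A) ⇒ ι ⇒ A) ⇒ A

-- η_A = λ z e b. e z
ηT : ∀ {Γ} A → Tm Γ (ι ⇒ ChD A ι)
ηT A = lam (lam (lam (app (var (vs vz)) (var (vs (vs vz))))))

-- β_A = λ φ x e b. b (λ y. φ y e b) x
βT : ∀ {Γ} A → Tm Γ ((ι ⇒ ChD A ι) ⇒ ι ⇒ ChD A ι)
βT A = lam (lam (lam (lam
         (app (app (var vz)
                   (lam (app (app (app (var (vs (vs (vs (vs vz))))) (var vz))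
                                  (var (vs (vs vz))))
                             (var (vs vz)))))
              (var (vs (vs vz)))))))

-- K_A = λ f d e' b'. d (λ x. f x e' b') b'
KT : ∀ {Γ} A X Y → Tm Γ ((X ⇒ ChD A Y) ⇒ ChD A X ⇒ ChD A Y)
KT A X Y = lam (lam (lam (lam
         (app (app (var (vs (vs vz)))
                   (lam (app (app (app (var (vs (vs (vs (vs vz))))) (var vz))
                                  (var (vs (vs vz))))
                             (var (vs vz)))))
              (var vz)))))

mapT : ∀ {Γ} A → Tm Γ ((ι ⇒ ι) ⇒ ChD A ι ⇒ ChD A ι)
mapT A = lam (app (KT A ι ι) (lam (app (ηT A) (app (var (vs vz)) (var vz)))))

⌈_⌉ty : Ty → Ty → Ty
⌈ ι ⌉ty     A = ChD A ι
⌈ σ ⇒ τ ⌉ty A = ⌈ σ ⌉ty A ⇒ ⌈ τ ⌉ty A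

⌈_⌉ctx : Ctx → Ty → Ctx
⌈ ∅ ⌉ctx     A = ∅
⌈ Γ , σ ⌉ctx A = ⌈ Γ ⌉ctx A , ⌈ σ ⌉ty A

⌈_⌉var : ∀ {Γ σ} → Γ ∋ σ → (A : Ty) → ⌈ Γ ⌉ctx A ∋ ⌈ σ ⌉ty A
⌈ vz ⌉var   A = vz
⌈ vs x ⌉var A = vs (⌈ x ⌉var A)

extT : ∀ {Γ} σ A → Tm Γ ((ι ⇒ ⌈ σ ⌉ty A) ⇒ ⌈ ι ⌉ty A ⇒ ⌈ σ ⌉ty A)
extT ι         A = KT A ι ι
extT (σ₁ ⇒ σ₂) A = lam (lam (lam
  (app (app (extT σ₂ A)
            (lam (app (app (var (vs (vs (vs vz)))) (var vz)) (var (vs vz)))))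
       (var (vs vz)))))

⌈_⌉ : ∀ {Γ σ} → Tm Γ σ → (A : Ty) → Tm (⌈ Γ ⌉ctx A) (⌈ σ ⌉ty A)
⌈ var x ⌉ A              = var (⌈ x ⌉var A)
⌈ Zero ⌉ A               = app (ηT A) Zero
⌈ Succ t ⌉ A             = app (app (mapT A) (lam (Succ (var vz)))) (⌈ t ⌉ A)
⌈ Rec {σ} t₁ t₂ t₃ ⌉ A   =
  app (app (extT σ A)
           (lam (Rec (lam (app (wk (wk (⌈ t₁ ⌉ A))) (app (ηT A) (var vz))))
                     (wk (⌈ t₂ ⌉ A))
                     (var vz))))
      (⌈ t₃ ⌉ A)
⌈ lam t ⌉ A              = lam (⌈ t ⌉ A)
⌈ app t u ⌉ A            = app (⌈ t ⌉ A) (⌈ u ⌉ A)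

genericT : ∀ {Γ} A → Tm Γ (ChD A ι ⇒ ChD A ι)
genericT A = app (KT A ι ι) (lam (app (app (βT A) (ηT A)) (var vz)))

dialogueTreeT : (A : Ty) → Tm ∅ ((ι ⇒ ι) ⇒ ι) → Tm ∅ (ChD A ι)
dialogueTreeT A t = app (⌈ t ⌉ A) (genericT A)

-- maxBQ^T = λ d. d (λ w. zero) (λ g x. max^T x (max^T (g 0) (g 1)))
-- parameterised by the fixed closed term max^T
maxBQT : ∀ {Γ} → Tm ∅ (ι ⇒ ι ⇒ ι) → Tm Γ (ChD ι ι ⇒ ι)
maxBQT mx = lam (app (app (var vz) (lam Zero))
  (lam (lam (app (app (closed mx) (var vz))
                 (app (app (closed mx) (app (var (vs vz)) (numeral 0)))
                      (app (var (vs vz)) (numeral 1)))))))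

-- The internal translation ⌈ t ⌉ A is the Church encoding of the dialogue tree B⟦ t ⟧: a
-- logical relation, whose base case says "applying the Church encoding c to a leaf map e
-- and a branch algebra b gives the fold of the tree d with e and b", is preserved by every
-- term former, the recursor case following from the fact that fold commutes with Kleisli
-- extension. Evaluating maxBQᵀ applies the Church encoding to the algebra
-- b g i = max i (max (g 0) (g 1)), whose fold is maxBQ ∘ prune.
module Submission where

open import Defs hiding (_,_)
open import Data.Nat using (ℕ; zero; suc; _⊔_)
open import Data.Product using (∃-syntax; _×_; _,_)
open import Relation.Binary.PropositionalEquality
  using (_≡_; refl; sym; trans; cong; cong₂; subst; module ≡-Reasoning)

ren-cong : ∀ {Γ Δ σ} {ρ ρ′ : Ren Γ Δ} → (∀ {τ} (x : Γ ∋ τ) → ρ x ≡ ρ′ x)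
         → (t : Tm Γ σ) → ren ρ t ≡ ren ρ′ t
ren-cong h (var x)     = cong var (h x)
ren-cong h Zero        = refl
ren-cong h (Succ t)    = cong Succ (ren-cong h t)
ren-cong h (Rec t p q) rewrite ren-cong h t | ren-cong h p | ren-cong h q = refl
ren-cong {ρ = ρ} {ρ′} h (lam t) = cong lam (ren-cong lift-h t)
  where
  lift-h : ∀ {τ} x → liftRen ρ {τ} x ≡ liftRen ρ′ x
  lift-h vz     = refl
  lift-h (vs x) = cong vs (h x)
ren-cong h (app t u)   = cong₂ app (ren-cong h t) (ren-cong h u)

ren-ren : ∀ {Γ Δ Θ σ} (ρ : Ren Δ Θ) (ρ′ : Ren Γ Δ) (t : Tm Γ σ)
        → ren ρ (ren ρ′ t) ≡ ren (λ x → ρ (ρ′ x)) t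
ren-ren ρ ρ′ (var x)     = refl
ren-ren ρ ρ′ Zero        = refl
ren-ren ρ ρ′ (Succ t)    = cong Succ (ren-ren ρ ρ′ t)
ren-ren ρ ρ′ (Rec t p q) rewrite ren-ren ρ ρ′ t | ren-ren ρ ρ′ p | ren-ren ρ ρ′ q = refl
ren-ren ρ ρ′ (lam t)     =
  cong lam (trans (ren-ren (liftRen ρ) (liftRen ρ′) t) (ren-cong lift-∘ t))
  where
  lift-∘ : ∀ {τ} x → liftRen ρ (liftRen ρ′ {τ} x) ≡ liftRen (λ y → ρ (ρ′ y)) x
  lift-∘ vz     = refl
  lift-∘ (vs x) = refl
ren-ren ρ ρ′ (app t u)   = cong₂ app (ren-ren ρ ρ′ t) (ren-ren ρ ρ′ u)

ren-id : ∀ {Γ σ} (ρ : Ren Γ Γ) → (∀ {τ} (x : Γ ∋ τ) → ρ x ≡ x)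
       → (t : Tm Γ σ) → ren ρ t ≡ t
ren-id ρ h (var x)     = cong var (h x)
ren-id ρ h Zero        = refl
ren-id ρ h (Succ t)    = cong Succ (ren-id ρ h t)
ren-id ρ h (Rec t p q) rewrite ren-id ρ h t | ren-id ρ h p | ren-id ρ h q = refl
ren-id ρ h (lam t)     = cong lam (ren-id (liftRen ρ) lift-h t)
  where
  lift-h : ∀ {τ} x → liftRen ρ {τ} x ≡ x
  lift-h vz     = refl
  lift-h (vs x) = cong vs (h x)
ren-id ρ h (app t u)   = cong₂ app (ren-id ρ h t) (ren-id ρ h u)

ren-extT : ∀ {Γ Δ} σ A (ρ : Ren Γ Δ) → ren ρ (extT σ A) ≡ extT σ A
ren-extT ι         A ρ = refl
ren-extT (σ₁ ⇒ σ₂) A ρ =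
  cong (λ u → lam (lam (lam (app (app u (lam (app (app (var (vs (vs (vs vz)))) (var vz))
                                                  (var (vs vz)))))
                                 (var (vs vz))))))
       (ren-extT σ₂ A (liftRen (liftRen (liftRen ρ))))

Natrec-preserves : {X Y : Set} (R : X → Y → Set) {f : ℕ → X → X} {g : ℕ → Y → Y} {z : X} {z′ : Y}
                 → (∀ m {x y} → R x y → R (f m x) (g m y)) → R z z′
                 → ∀ n → R (Natrec f z n) (Natrec g z′ n)
Natrec-preserves R step base zero    = base
Natrec-preserves R step base (suc n) = step n (Natrec-preserves R step base n)

-- Without function extensionality, environments agreeing pointwise need not be equal, so
-- semantic values are compared by the extensional logical relation instead of _≡_.
Eq⟦_⟧ : ∀ σ → ⟦ σ ⟧ty → ⟦ σ ⟧ty → Set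
Eq⟦ ι ⟧     a b = a ≡ b
Eq⟦ σ ⇒ τ ⟧ f g = ∀ x y → Eq⟦ σ ⟧ x y → Eq⟦ τ ⟧ (f x) (g y)

⟦ren⟧-Eq : ∀ {Γ Δ σ} (t : Tm Γ σ) (ρ : Ren Γ Δ) (δ : Env Δ) (γ : Env Γ)
         → (∀ {τ} (x : Γ ∋ τ) → Eq⟦ τ ⟧ (δ (ρ x)) (γ x))
         → Eq⟦ σ ⟧ (⟦ ren ρ t ⟧ δ) (⟦ t ⟧ γ)
⟦ren⟧-Eq (var x)         ρ δ γ h = h x
⟦ren⟧-Eq Zero            ρ δ γ h = refl
⟦ren⟧-Eq (Succ t)        ρ δ γ h = cong suc (⟦ren⟧-Eq t ρ δ γ h)
⟦ren⟧-Eq (Rec {σ} t p q) ρ δ γ h rewrite ⟦ren⟧-Eq q ρ δ γ h =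
  Natrec-preserves Eq⟦ σ ⟧ (λ m → ⟦ren⟧-Eq t ρ δ γ h m m refl _ _) (⟦ren⟧-Eq p ρ δ γ h) (⟦ q ⟧ γ)
⟦ren⟧-Eq (lam t)         ρ δ γ h x y x≈y =
  ⟦ren⟧-Eq t (liftRen ρ) (extEnv δ x) (extEnv γ y) h′
  where
  h′ : ∀ {τ} z → Eq⟦ τ ⟧ (extEnv δ x (liftRen ρ z)) (extEnv γ y z)
  h′ vz     = x≈y
  h′ (vs z) = h z
⟦ren⟧-Eq (app t u)       ρ δ γ h = ⟦ren⟧-Eq t ρ δ γ h _ _ (⟦ren⟧-Eq u ρ δ γ h)

⟦closed⟧-Eq : ∀ {Γ σ} (t : Tm ∅ σ) (δ : Env Γ) → Eq⟦ σ ⟧ (⟦ closed t ⟧ δ) ⟦ t ⟧₀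
⟦closed⟧-Eq t δ = ⟦ren⟧-Eq t emptyRen δ emptyEnv (λ ())

foldD : {X : Set} → (ℕ → X) → ((ℕ → X) → ℕ → X) → Dℕ → X
foldD e b (η x)   = e x
foldD e b (β φ i) = b (λ o → foldD e b (φ o)) i

Extensional : {X : Set} → ((ℕ → X) → ℕ → X) → Set
Extensional b = ∀ g g′ i → (∀ o → g o ≡ g′ o) → b g i ≡ b g′ i

module _ {X : Set} {b : (ℕ → X) → ℕ → X} (b-ext : Extensional b) where

  foldD-cong : {e e′ : ℕ → X} → (∀ x → e x ≡ e′ x) → ∀ d → foldD e b d ≡ foldD e′ b d
  foldD-cong e≗e′ (η x)   = e≗e′ x
  foldD-cong e≗e′ (β φ i) = b-ext _ _ i (λ o → foldD-cong e≗e′ (φ o))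

  foldD-kleisli : {e : ℕ → X} (f : ℕ → Dℕ) (d : Dℕ)
                → foldD e b (kleisli f d) ≡ foldD (λ x → foldD e b (f x)) b d
  foldD-kleisli f (η x)   = refl
  foldD-kleisli f (β φ i) = b-ext _ _ i (λ o → foldD-kleisli f (φ o))

module Representation (A : Ty) where

  Represents : ∀ σ → ⟦ ⌈ σ ⌉ty A ⟧ty → B⟦ σ ⟧ty → Set
  Represents ι       c d = ∀ e b → Extensional b → c e b ≡ foldD e b d
  Represents (σ ⇒ τ) f g = ∀ x y → Represents σ x y → Represents τ (f x) (g y)

  RepresentsEnv : ∀ {Γ Δ} → Ren (⌈ Γ ⌉ctx A) Δ → Env Δ → BEnv Γ → Set
  RepresentsEnv {Γ} ρ δ γ = ∀ {τ} (x : Γ ∋ τ) → Represents τ (δ (ρ (⌈ x ⌉var A))) (γ x)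

  RepresentsEnv-ext : ∀ {Γ Δ σ} {ρ : Ren (⌈ Γ ⌉ctx A) Δ} {δ : Env Δ} {γ : BEnv Γ} {x y}
                    → RepresentsEnv ρ δ γ → Represents σ x y
                    → RepresentsEnv (liftRen ρ) (extEnv δ x) (extBEnv γ y)
  RepresentsEnv-ext h r vz     = r
  RepresentsEnv-ext h r (vs z) = h z

  extT-represents : ∀ σ {Δ} (δ : Env Δ) (f′ : ℕ → ⟦ ⌈ σ ⌉ty A ⟧ty) (f : ℕ → B⟦ σ ⟧ty) c d
                  → (∀ n → Represents σ (f′ n) (f n)) → Represents ι c d
                  → Represents σ (⟦ extT σ A ⟧ δ f′ c) (ext σ f d)
  extT-represents ι δ f′ f c d f′∼f c∼d e b b-ext = begin
    c (λ x → f′ x e b) b                  ≡⟨ c∼d _ b b-ext ⟩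
    foldD (λ x → f′ x e b) b d            ≡⟨ foldD-cong b-ext (λ x → f′∼f x e b b-ext) d ⟩
    foldD (λ x → foldD e b (f x)) b d     ≡⟨ foldD-kleisli b-ext f d ⟨
    foldD e b (kleisli f d)               ∎
    where open ≡-Reasoning
  extT-represents (σ₁ ⇒ σ₂) δ f′ f c d f′∼f c∼d s s′ s∼s′ =
    extT-represents σ₂ _ (λ x → f′ x s) (λ x → f x s′) c d (λ n → f′∼f n s s′ s∼s′) c∼d

  ⌈⌉-represents : ∀ {Γ Δ σ} (t : Tm Γ σ) (ρ : Ren (⌈ Γ ⌉ctx A) Δ) (δ : Env Δ) (γ : BEnv Γ)
                → RepresentsEnv ρ δ γ → Represents σ (⟦ ren ρ (⌈ t ⌉ A) ⟧ δ) (B⟦ t ⟧ γ)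
  ⌈⌉-represents (var x)  ρ δ γ h = h x
  ⌈⌉-represents Zero     ρ δ γ h e b b-ext = refl
  ⌈⌉-represents (Succ t) ρ δ γ h e b b-ext =
    trans (⌈⌉-represents t ρ δ γ h _ b b-ext) (sym (foldD-kleisli b-ext (λ x → η (suc x)) (B⟦ t ⟧ γ)))
  ⌈⌉-represents (Rec {σ} t₁ t₂ t₃) ρ δ γ h rewrite ren-extT σ A ρ =
    extT-represents σ δ _ _ _ _ (λ n → Natrec-preserves (Represents σ) (step n) (base n) n)
                    (⌈⌉-represents t₃ ρ δ γ h)
    where
    ρ₂ : Ren (⌈ _ ⌉ctx A) _
    ρ₂ y = vs (vs (ρ y))
    t₁-ren : ren (liftRen (liftRen ρ)) (wk (wk (⌈ t₁ ⌉ A))) ≡ ren ρ₂ (⌈ t₁ ⌉ A)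
    t₁-ren = trans (ren-ren _ vs (wk (⌈ t₁ ⌉ A))) (ren-ren _ vs (⌈ t₁ ⌉ A))
    step : ∀ n m {x y} → Represents σ x y
         → Represents σ (⟦ ren (liftRen (liftRen ρ)) (wk (wk (⌈ t₁ ⌉ A))) ⟧
                           (extEnv (extEnv δ n) m) (λ e b → e m) x)
                        (B⟦ t₁ ⟧ γ (η m) y)
    step n m = subst (λ u → Represents (ι ⇒ σ ⇒ σ) (⟦ u ⟧ (extEnv (extEnv δ n) m)) (B⟦ t₁ ⟧ γ))
                     (sym t₁-ren) (⌈⌉-represents t₁ ρ₂ _ γ h) _ (η m) (λ e b b-ext → refl) _ _
    base : ∀ n → Represents σ (⟦ ren (liftRen ρ) (wk (⌈ t₂ ⌉ A)) ⟧ (extEnv δ n)) (B⟦ t₂ ⟧ γ)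
    base n = subst (λ u → Represents σ (⟦ u ⟧ (extEnv δ n)) (B⟦ t₂ ⟧ γ))
                   (sym (ren-ren _ vs (⌈ t₂ ⌉ A))) (⌈⌉-represents t₂ (λ y → vs (ρ y)) _ γ h)
  ⌈⌉-represents (lam t)   ρ δ γ h x y x∼y =
    ⌈⌉-represents t (liftRen ρ) (extEnv δ x) (extBEnv γ y) (RepresentsEnv-ext h x∼y)
  ⌈⌉-represents (app t u) ρ δ γ h = ⌈⌉-represents t ρ δ γ h _ _ (⌈⌉-represents u ρ δ γ h)

  genericT-represents : ∀ {Γ} (δ : Env Γ) → Represents (ι ⇒ ι) (⟦ genericT A ⟧ δ) generic
  genericT-represents δ c d c∼d e b b-ext =
    trans (c∼d _ b b-ext) (sym (foldD-kleisli b-ext (λ i → β η i) d))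

  dialogueTreeT-represents : (t : Tm ∅ ((ι ⇒ ι) ⇒ ι))
                           → Represents ι ⟦ dialogueTreeT A t ⟧₀ (dialogueTree t)
  dialogueTreeT-represents t =
    subst (λ u → Represents ((ι ⇒ ι) ⇒ ι) ⟦ u ⟧₀ (B⟦ t ⟧ emptyBEnv))
          (ren-id (λ x → x) (λ x → refl) (⌈ t ⌉ A))
          (⌈⌉-represents t (λ x → x) emptyEnv emptyBEnv (λ ()))
          _ _ (genericT-represents emptyEnv)

module _ {b : (ℕ → ℕ) → ℕ → ℕ} (b-max : ∀ g i → b g i ≡ i ⊔ (g 0 ⊔ g 1)) where

  maxBQ-algebra-extensional : Extensional b
  maxBQ-algebra-extensional g g′ i g≗g′ = begin
    b g i                  ≡⟨ b-max g i ⟩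
    i ⊔ (g 0 ⊔ g 1)        ≡⟨ cong (i ⊔_) (cong₂ _⊔_ (g≗g′ 0) (g≗g′ 1)) ⟩
    i ⊔ (g′ 0 ⊔ g′ 1)      ≡⟨ b-max g′ i ⟨
    b g′ i                 ∎
    where open ≡-Reasoning

  foldD-maxBQ-algebra : ∀ d → foldD (λ _ → 0) b d ≡ maxBQ (prune d)
  foldD-maxBQ-algebra (η x)   = refl
  foldD-maxBQ-algebra (β φ i) =
    trans (b-max _ i) (cong (i ⊔_) (cong₂ _⊔_ (foldD-maxBQ-algebra (φ 0)) (foldD-maxBQ-algebra (φ 1))))

maxBQT-unfolds : (maxT : Tm ∅ (ι ⇒ ι ⇒ ι)) → (∀ a b → ⟦ maxT ⟧₀ a b ≡ a ⊔ b)
               → (c : Tm ∅ (ChD ι ι))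
               → ∃[ b ] (∀ g i → b g i ≡ i ⊔ (g 0 ⊔ g 1))
                        × ⟦ app (maxBQT maxT) c ⟧₀ ≡ ⟦ c ⟧₀ (λ _ → 0) b
-- b is the meaning of the branch λ-term of maxBQᵀ; unification against refl supplies it.
maxBQT-unfolds maxT maxT-max c = _ , (λ g i → trans (max i _) (cong (i ⊔_) (max (g 0) (g 1)))) , refl
  where
  max : ∀ {Γ} {δ : Env Γ} a b → ⟦ closed maxT ⟧ δ a b ≡ a ⊔ b
  max {δ = δ} a b = trans (⟦closed⟧-Eq maxT δ a a refl b b refl) (maxT-max a b)

lemma54 : (maxT : Tm ∅ (ι ⇒ ι ⇒ ι))
        → (∀ a b → ⟦ maxT ⟧₀ a b ≡ a ⊔ b)
        → (t : Tm ∅ ((ι ⇒ ι) ⇒ ι))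
        → ⟦ app (maxBQT maxT) (dialogueTreeT ι t) ⟧₀ ≡ maxBQ (prune (dialogueTree t))
lemma54 maxT maxT-max t with maxBQT-unfolds maxT maxT-max (dialogueTreeT ι t)
... | b , b-max , unfold = begin
  ⟦ app (maxBQT maxT) (dialogueTreeT ι t) ⟧₀  ≡⟨ unfold ⟩
  ⟦ dialogueTreeT ι t ⟧₀ (λ _ → 0) b          ≡⟨ dialogueTreeT-represents t _ b (maxBQ-algebra-extensional b-max) ⟩
  foldD (λ _ → 0) b (dialogueTree t)          ≡⟨ foldD-maxBQ-algebra b-max (dialogueTree t) ⟩
  maxBQ (prune (dialogueTree t))              ∎
  where
  open ≡-Reasoning
  open Representation ι
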